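{- There exists $n_0$ such that for every integer $\omega\ge2$ and every graph $H$ on $n\ge n_0$ vertices with no clique of size greater than $\omega$, \[ \log_2(i(H))\ge\frac{\log_2^2(n)}{2e\log_2(\omega)}. \]
   Context: For a graph $H$, $i(H)$ is the number of independent sets of $H$ (including the empty set). -}

module Defs where

open import Data.Nat as ℕ using (ℕ; zero; suc; _^_; _!)
open import Data.Nat.Properties using (_!≢0)
open import Data.Bool using (Bool; true; false; T; if_then_else_)
open import Data.Fin using (Fin)
open import Data.Fin.Subset using (Subset; _∈_; ∣_∣)
open import Data.Vec using (Vec; []; _∷_)
open import Data.List using (List; []; _∷_; map; _++_; length; filter)
open import Data.Integer using (ℤ; +_; -[1+_])
open import Data.Rational using (ℚ; 0ℚ; 1ℚ; _+_; _*_; _≤_; _<_; _/_; ↥_; ↧ₙ_)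
open import Data.Product using (Σ; _×_; ∃)
open import Relation.Binary.PropositionalEquality using (_≡_; _≢_)
open import Relation.Nullary using (¬_; Dec; yes; no)
open import Relation.Unary using (Pred)

record Graph (n : ℕ) : Set where
  field
    Adj       : Fin n → Fin n → Bool
    symmetric : ∀ u v → Adj u v ≡ Adj v u
    irreflex  : ∀ v → Adj v v ≡ false
open Graph public

Independent : ∀ {n} → Graph n → Subset n → Set
Independent H S = ∀ u v → u ∈ S → v ∈ S → Adj H u v ≡ false

IsClique : ∀ {n} → Graph n → Subset n → Set
IsClique H S = ∀ u v → u ∈ S → v ∈ S → u ≢ v → Adj H u v ≡ true

CliqueFreeAbove : ∀ {n} → Graph n → ℕ → Set
CliqueFreeAbove H ω = ∀ S → IsClique H S → ∣ S ∣ ℕ.≤ ω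

allSubsets : (n : ℕ) → List (Subset n)
allSubsets zero    = [] ∷ []
allSubsets (suc n) = map (true ∷_) (allSubsets n) ++ map (false ∷_) (allSubsets n)

open import Data.Fin.Properties using (all?)
open import Data.Bool.Properties using (_≟_)
open import Relation.Nullary.Decidable using (_→-dec_)
open import Data.Fin.Subset.Properties using (_∈?_)

independent? : ∀ {n} (H : Graph n) (S : Subset n) → Dec (Independent H S)
independent? H S =
  all? λ u → all? λ v → (u ∈? S) →-dec ((v ∈? S) →-dec (Adj H u v ≟ false))

-- i(H): the number of independent sets of H (including the empty set)
indepCount : ∀ {n} → Graph n → ℕ
indepCount H = length (filter (independent? H) (allSubsets _))

-- Real-number comparisons, expressed exactly via rationals.
-- log₂ m < a   iff  a = p/q with p ≥ 0 and m^q < 2^p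
Log2Lt : ℕ → ℚ → Set
Log2Lt m a = Σ ℕ λ p → (↥ a ≡ + p) × (m ^ ↧ₙ a ℕ.< 2 ^ p)

-- a < log₂ m   for a ≥ 0 : a = p/q with 2^p < m^q
Log2Gt : ℕ → ℚ → Set
Log2Gt m a = Σ ℕ λ p → (↥ a ≡ + p) × (2 ^ p ℕ.< m ^ ↧ₙ a)

-- partial sums  Σ_{k<N} 1/k!  of e
ePartial : ℕ → ℚ
ePartial zero    = 0ℚ
ePartial (suc N) = ePartial N + (+ 1 / (N !)) {{N !≢0}}

-- e < c  (e = sup of the increasing partial sums)
eLt : ℚ → Set
eLt c = Σ ℚ λ w → (w < c) × (∀ N → ePartial N ≤ w)

-- The real inequality  log₂(i) ≥ log₂²(n) / (2 e log₂ ω),  for ω ≥ 2 (so log₂ ω > 0),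
-- equivalently  log₂²(n) ≤ 2 · e · log₂ ω · log₂ i.  For nonnegative reals
-- X,Y,Z,W this holds iff for all rationals x > X, y > Y, z > Z and 0 ≤ w < W
-- we have w² ≤ 2·x·y·z.
LogBound : (n ω i : ℕ) → Set
LogBound n ω i =
  ∀ (x y z w : ℚ) → Log2Lt i x → Log2Lt ω y → eLt z → Log2Gt n w →
  w * w ≤ ((+ 2 / 1) * x) * (y * z)

module Submission where

-- A graph with n vertices and no clique larger than ω has at least n^k / ω^(k²)
-- independent sets, for every k.  By induction on ω, k and n: if n ≤ ω^k this is trivial;
-- otherwise pick a vertex v.  If v has at least ⌊n/ω⌋ non-neighbours, the independent sets
-- avoiding v and those containing v (an independent set of non-neighbours plus v) number
-- at least (n-1)^k / ω^(k²) + ⌊n/ω⌋^(k-1) / ω^((k-1)²) ≥ n^k / ω^(k²).  Otherwise v has at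
-- least n - ⌊n/ω⌋ neighbours, which span no clique larger than ω - 1 (an independent set
-- when ω = 2), and induction on ω applies there.
-- Hence log i ≥ k log n - k² log ω; choosing k ≈ log n / (2 log ω), or using i > n when
-- log n < 2 log ω, gives log² n ≤ (16/3) log ω log i, and 16/3 < 2e.

open import Defs
open import Data.Nat as ℕ using (ℕ; zero; suc; _+_; _*_; _^_; _≤_; _<_; s≤s; z≤n; _≤?_; NonZero; >-nonZero; >-nonZero⁻¹)
open import Data.Nat.Properties
open import Data.Nat.DivMod using (_/_; _%_; m≡m%n+[m/n]*n; m%n<n; m/n*n≤m; m≥n⇒m/n>0)
open import Data.Nat.Tactic.RingSolver using (solve-∀)
open import Data.Bool using (Bool; true; false)
open import Data.Bool.Properties using (¬-not)
open import Data.Fin using (Fin; zero; suc; splitAt; join)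
open import Data.Fin.Properties using (join-splitAt; injective⇒≤)
open import Data.Fin.Subset
  using (Subset; _∈_; _∉_; _⊆_; ∣_∣; _∩_; _∪_; _-_; ⁅_⁆; ∁; Nonempty; Empty; ⊥; ⊤)
open import Data.Fin.Subset.Properties
  using (p─⊥≡p; ⊆-antisym; x∈p∩q⁺; x∈p∩q⁻; x∈p∪q⁺; x∈p∪q⁻; x∈⁅x⁆; x∈⁅y⁆⇒x≡y;
         p─q⊆p; x∈p∧x≢y⇒x∈p-y; x∈∁p⇒x∉p; ∉⊥; ⊥⊆; Empty-unique; ∣⊥∣≡0; ∣⊤∣≡n; ∣⁅x⁆∣≡1)
open import Data.Integer as ℤ using (+≤+)
import Data.Integer.Properties as ℤP
open import Data.Rational as ℚ using (ℚ; mkℚ; ↥_; ↧ₙ_; toℚᵘ)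
import Data.Rational.Properties as ℚP
import Data.Rational.Unnormalised as ℚᵘ
import Data.Rational.Unnormalised.Properties as ℚᵘP
open import Data.Vec using (_∷_; []; here; there; tabulate)
open import Data.Vec.Properties using ([]=⇒lookup; lookup⇒[]=; lookup∘tabulate)
open import Data.List using (map; filter)
import Data.List as List
open import Data.List.Membership.Propositional using () renaming (_∈_ to _∈ₗ_)
open import Data.List.Membership.Propositional.Properties using (∈-map⁺; ∈-++⁺ˡ; ∈-++⁺ʳ; ∈-filter⁺)
open import Data.List.Relation.Unary.Any using (index) renaming (here to hereₗ)
open import Data.List.Relation.Unary.Any.Properties using (lookup-index)
open import Data.Product using (Σ; Σ-syntax; _×_; _,_; proj₁; proj₂)
open import Data.Sum using (_⊎_; inj₁; inj₂; [_,_]′)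
open import Data.Empty using (⊥-elim)
open import Function using (_∘_)
open import Function.Definitions using (Injective)
open import Relation.Binary.PropositionalEquality
open import Relation.Nullary using (yes; no)

private variable
  m n : ℕ
  p q : Subset n
  x y : Fin n

-- Subsets

x∉p-x : ∀ (p : Subset n) x → x ∉ p - x
x∉p-x (_ ∷ p) zero    ()
x∉p-x (_ ∷ p) (suc x) (there x∈p-x) = x∉p-x p x x∈p-x

x∈p-y⇒x≢y : x ∈ p - y → x ≢ y
x∈p-y⇒x≢y {p = p} x∈p-x refl = x∉p-x p _ x∈p-x

x∈p-y⇒x∈p : x ∈ p - y → x ∈ p
x∈p-y⇒x∈p {p = p} {y = y} = p─q⊆p p ⁅ y ⁆

x∈p⇒∣p∣≡1+∣p-x∣ : x ∈ p → ∣ p ∣ ≡ suc ∣ p - x ∣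
x∈p⇒∣p∣≡1+∣p-x∣ {p = true ∷ p} here          = cong (suc ∘ ∣_∣) (sym (p─⊥≡p p))
x∈p⇒∣p∣≡1+∣p-x∣ {p = true ∷ p}  (there x∈p) = cong suc (x∈p⇒∣p∣≡1+∣p-x∣ x∈p)
x∈p⇒∣p∣≡1+∣p-x∣ {p = false ∷ p} (there x∈p) = x∈p⇒∣p∣≡1+∣p-x∣ x∈p

x∈p⇒∣p-x∣≡m : x ∈ p → ∣ p ∣ ≡ suc m → ∣ p - x ∣ ≡ m
x∈p⇒∣p-x∣≡m x∈p ∣p∣≡ = suc-injective (trans (sym (x∈p⇒∣p∣≡1+∣p-x∣ x∈p)) ∣p∣≡)

∣p∩q∣+∣p∩∁q∣≡∣p∣ : ∀ (p q : Subset n) → ∣ p ∩ q ∣ + ∣ p ∩ ∁ q ∣ ≡ ∣ p ∣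
∣p∩q∣+∣p∩∁q∣≡∣p∣ []          []          = refl
∣p∩q∣+∣p∩∁q∣≡∣p∣ (true ∷ p)  (true ∷ q)  = cong suc (∣p∩q∣+∣p∩∁q∣≡∣p∣ p q)
∣p∩q∣+∣p∩∁q∣≡∣p∣ (true ∷ p)  (false ∷ q) = trans (+-suc _ _) (cong suc (∣p∩q∣+∣p∩∁q∣≡∣p∣ p q))
∣p∩q∣+∣p∩∁q∣≡∣p∣ (false ∷ p) (_ ∷ q)     = ∣p∩q∣+∣p∩∁q∣≡∣p∣ p q

x∈p∪⁅y⁆⇒x∈p⊎x≡y : x ∈ p ∪ ⁅ y ⁆ → x ∈ p ⊎ x ≡ y
x∈p∪⁅y⁆⇒x∈p⊎x≡y {p = p} {y = y} x∈ with x∈p∪q⁻ p ⁅ y ⁆ x∈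
... | inj₁ x∈p   = inj₁ x∈p
... | inj₂ x∈⁅y⁆ = inj₂ (x∈⁅y⁆⇒x≡y y x∈⁅y⁆)

x∉p⇒[p∪⁅x⁆]-x≡p : x ∉ p → p ∪ ⁅ x ⁆ - x ≡ p
x∉p⇒[p∪⁅x⁆]-x≡p {x = x} {p = p} x∉p = ⊆-antisym ⊆p p⊆
  where
  ⊆p : p ∪ ⁅ x ⁆ - x ⊆ p
  ⊆p y∈ with x∈p∪⁅y⁆⇒x∈p⊎x≡y (x∈p-y⇒x∈p y∈)
  ... | inj₁ y∈p = y∈p
  ... | inj₂ y≡x = ⊥-elim (x∈p-y⇒x≢y y∈ y≡x)
  p⊆ : p ⊆ p ∪ ⁅ x ⁆ - x
  p⊆ y∈p = x∈p∧x≢y⇒x∈p-y (x∈p∪q⁺ (inj₁ y∈p)) λ { refl → x∉p y∈p }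

x∉p⇒∣p∪⁅x⁆∣≡1+∣p∣ : x ∉ p → ∣ p ∪ ⁅ x ⁆ ∣ ≡ suc ∣ p ∣
x∉p⇒∣p∪⁅x⁆∣≡1+∣p∣ {x = x} {p = p} x∉p =
  trans (x∈p⇒∣p∣≡1+∣p-x∣ {p = p ∪ ⁅ x ⁆} (x∈p∪q⁺ (inj₂ (x∈⁅x⁆ x)))) (cong (suc ∘ ∣_∣) (x∉p⇒[p∪⁅x⁆]-x≡p x∉p))

∪⁅x⁆-injective : x ∉ p → x ∉ q → p ∪ ⁅ x ⁆ ≡ q ∪ ⁅ x ⁆ → p ≡ q
∪⁅x⁆-injective x∉p x∉q eq =
  trans (sym (x∉p⇒[p∪⁅x⁆]-x≡p x∉p)) (trans (cong (_- _) eq) (x∉p⇒[p∪⁅x⁆]-x≡p x∉q))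

∣p∣≡1+m⇒Nonempty : ∀ {m} (p : Subset n) → ∣ p ∣ ≡ suc m → Nonempty p
∣p∣≡1+m⇒Nonempty (true ∷ p)  _ = zero , here
∣p∣≡1+m⇒Nonempty (false ∷ p) ∣p∣≡ with ∣p∣≡1+m⇒Nonempty p ∣p∣≡
... | x , x∈p = suc x , there x∈p

Empty⇒∣p∣≡0 : ∀ {n} {p : Subset n} → Empty p → ∣ p ∣ ≡ 0
Empty⇒∣p∣≡0 {n = n} empty = trans (cong ∣_∣ (Empty-unique empty)) (∣⊥∣≡0 n)

module _ {f : Fin n → Bool} where

  ∈-tabulate⁺ : f x ≡ true → x ∈ tabulate f
  ∈-tabulate⁺ {x = x} fx≡true = lookup⇒[]= x _ (trans (lookup∘tabulate f x) fx≡true)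

  ∈-tabulate⁻ : x ∈ tabulate f → f x ≡ true
  ∈-tabulate⁻ {x = x} x∈ = trans (sym (lookup∘tabulate f x)) ([]=⇒lookup x∈)

  ∈-∁tabulate⁻ : x ∈ ∁ (tabulate f) → f x ≡ false
  ∈-∁tabulate⁻ x∈ = ¬-not (x∈∁p⇒x∉p x∈ ∘ ∈-tabulate⁺)

∈-allSubsets : ∀ (p : Subset n) → p ∈ₗ allSubsets n
∈-allSubsets []                = hereₗ refl
∈-allSubsets {suc n} (true ∷ p)  = ∈-++⁺ˡ (∈-map⁺ (true ∷_) (∈-allSubsets p))
∈-allSubsets {suc n} (false ∷ p) = ∈-++⁺ʳ (map (true ∷_) (allSubsets n)) (∈-map⁺ (false ∷_) (∈-allSubsets p))

splitAt-injective : ∀ m {n} → Injective _≡_ _≡_ (splitAt m {n})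
splitAt-injective m {n} {i} {j} eq = begin
  i                      ≡⟨ join-splitAt m n i ⟨
  join m n (splitAt m i) ≡⟨ cong (join m n) eq ⟩
  join m n (splitAt m j) ≡⟨ join-splitAt m n j ⟩
  j                      ∎
  where open ≡-Reasoning

module _ {a b c} {A : Set a} {B : Set b} {C : Set c} {f : A → C} {g : B → C} where

  [,]-injective : Injective _≡_ _≡_ f → Injective _≡_ _≡_ g → (∀ x y → f x ≢ g y) →
                  Injective _≡_ _≡_ [ f , g ]′
  [,]-injective f-inj g-inj f≢g {inj₁ x} {inj₁ y} eq = cong inj₁ (f-inj eq)
  [,]-injective f-inj g-inj f≢g {inj₁ x} {inj₂ y} eq = ⊥-elim (f≢g x y eq)
  [,]-injective f-inj g-inj f≢g {inj₂ x} {inj₁ y} eq = ⊥-elim (f≢g y x (sym eq))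
  [,]-injective f-inj g-inj f≢g {inj₂ x} {inj₂ y} eq = cong inj₂ (g-inj eq)

-- Independent sets and cliques inside a vertex subset

module _ {N : ℕ} (H : Graph N) where

  neighbours : Fin N → Subset N
  neighbours v = tabulate (Adj H v)

  nbrsIn nonNbrsIn : Subset N → Fin N → Subset N
  nbrsIn    A v = (A - v) ∩ neighbours v
  nonNbrsIn A v = (A - v) ∩ ∁ (neighbours v)

  CliqueBoundedIn : Subset N → ℕ → Set
  CliqueBoundedIn A ω = ∀ S → S ⊆ A → IsClique H S → ∣ S ∣ ≤ ω

  record IndepFamily (A : Subset N) (l : ℕ) : Set where
    field
      member      : Fin l → Subset N
      injective   : Injective _≡_ _≡_ member
      independent : ∀ i → Independent H (member i)
      member⊆A    : ∀ i → member i ⊆ A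

  private variable
    A B : Subset N
    u v : Fin N
    l l₁ l₂ ω : ℕ

  ∈nbrsIn⁻ : u ∈ nbrsIn A v → u ∈ A × u ≢ v × Adj H v u ≡ true
  ∈nbrsIn⁻ {A = A} {v = v} u∈ with x∈p∩q⁻ (A - v) (neighbours v) u∈
  ... | u∈A-v , u∈nbrs = x∈p-y⇒x∈p u∈A-v , x∈p-y⇒x≢y u∈A-v , ∈-tabulate⁻ u∈nbrs

  ∈nonNbrsIn⁻ : u ∈ nonNbrsIn A v → u ∈ A × u ≢ v × Adj H v u ≡ false
  ∈nonNbrsIn⁻ {A = A} {v = v} u∈ with x∈p∩q⁻ (A - v) (∁ (neighbours v)) u∈
  ... | u∈A-v , u∉nbrs = x∈p-y⇒x∈p u∈A-v , x∈p-y⇒x≢y u∈A-v , ∈-∁tabulate⁻ u∉nbrs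

  nbrsIn-⊆ : nbrsIn A v ⊆ A
  nbrsIn-⊆ = proj₁ ∘ ∈nbrsIn⁻

  nonNbrsIn-⊆ : nonNbrsIn A v ⊆ A
  nonNbrsIn-⊆ = proj₁ ∘ ∈nonNbrsIn⁻

  ∣nbrsIn∣+∣nonNbrsIn∣≡∣A-v∣ : ∀ A v → ∣ nbrsIn A v ∣ + ∣ nonNbrsIn A v ∣ ≡ ∣ A - v ∣
  ∣nbrsIn∣+∣nonNbrsIn∣≡∣A-v∣ A v = ∣p∩q∣+∣p∩∁q∣≡∣p∣ (A - v) (neighbours v)

  indepFamily-mono : A ⊆ B → IndepFamily A l → IndepFamily B l
  indepFamily-mono A⊆B F = record
    { member = member ; injective = injective ; independent = independent
    ; member⊆A = λ i → A⊆B ∘ member⊆A i }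
    where open IndepFamily F

  indepFamily-∅ : IndepFamily A 1
  indepFamily-∅ = record
    { member      = λ _ → ⊥
    ; injective   = λ { {zero} {zero} _ → refl }
    ; independent = λ _ _ _ u∈⊥ → ⊥-elim (∉⊥ u∈⊥)
    ; member⊆A    = λ _ → ⊥⊆
    }

  indepFamily-+ : v ∈ A → IndepFamily (A - v) l₁ → IndepFamily (nonNbrsIn A v) l₂ →
                  IndepFamily A (l₁ + l₂)
  indepFamily-+ {v = v} {A = A} {l₁ = l₁} {l₂ = l₂} v∈A F₁ F₂ = record
    { member      = member ∘ splitAt l₁
    ; injective   = splitAt-injective l₁ ∘ [,]-injective F₁.injective withV-injective disjoint
    ; independent = independent ∘ splitAt l₁
    ; member⊆A    = member⊆A ∘ splitAt l₁
    }
    where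
    module F₁ = IndepFamily F₁
    module F₂ = IndepFamily F₂

    withV : Fin l₂ → Subset N
    withV j = F₂.member j ∪ ⁅ v ⁆

    member : Fin l₁ ⊎ Fin l₂ → Subset N
    member = [ F₁.member , withV ]′

    v∉F₂ : ∀ j → v ∉ F₂.member j
    v∉F₂ j v∈ = proj₁ (proj₂ (∈nonNbrsIn⁻ (F₂.member⊆A j v∈))) refl

    withV-injective : Injective _≡_ _≡_ withV
    withV-injective eq = F₂.injective (∪⁅x⁆-injective (v∉F₂ _) (v∉F₂ _) eq)

    disjoint : ∀ i j → F₁.member i ≢ withV j
    disjoint i j eq = x∉p-x A v (F₁.member⊆A i (subst (v ∈_) (sym eq) (x∈p∪q⁺ (inj₂ (x∈⁅x⁆ v)))))

    independent : ∀ s → Independent H (member s)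
    independent (inj₁ i) = F₁.independent i
    independent (inj₂ j) u w u∈ w∈ with x∈p∪⁅y⁆⇒x∈p⊎x≡y u∈ | x∈p∪⁅y⁆⇒x∈p⊎x≡y w∈
    ... | inj₁ u∈F | inj₁ w∈F = F₂.independent j u w u∈F w∈F
    ... | inj₁ u∈F | inj₂ refl =
      trans (symmetric H u w) (proj₂ (proj₂ (∈nonNbrsIn⁻ (F₂.member⊆A j u∈F))))
    ... | inj₂ refl | inj₁ w∈F = proj₂ (proj₂ (∈nonNbrsIn⁻ (F₂.member⊆A j w∈F)))
    ... | inj₂ refl | inj₂ refl = irreflex H u

    member⊆A : ∀ s → member s ⊆ A
    member⊆A (inj₁ i) = x∈p-y⇒x∈p ∘ F₁.member⊆A i
    member⊆A (inj₂ j) u∈ with x∈p∪⁅y⁆⇒x∈p⊎x≡y u∈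
    ... | inj₁ u∈F = nonNbrsIn-⊆ (F₂.member⊆A j u∈F)
    ... | inj₂ refl = v∈A

  indepFamily⇒≤indepCount : IndepFamily A l → l ≤ indepCount H
  indepFamily⇒≤indepCount F = injective⇒≤ position-injective
    where
    open IndepFamily F
    independentSets = filter (independent? H) (allSubsets N)

    listed : ∀ i → member i ∈ₗ independentSets
    listed i = ∈-filter⁺ (independent? H) (∈-allSubsets (member i)) (independent i)

    position-injective : Injective _≡_ _≡_ (index ∘ listed)
    position-injective {i} {j} eq = injective (begin
      member i                                   ≡⟨ lookup-index (listed i) ⟩
      List.lookup independentSets (index (listed i)) ≡⟨ cong (List.lookup independentSets) eq ⟩
      List.lookup independentSets (index (listed j)) ≡⟨ lookup-index (listed j) ⟨
      member j                                   ∎)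
      where open ≡-Reasoning

  cliqueBoundedIn-mono : A ⊆ B → CliqueBoundedIn B ω → CliqueBoundedIn A ω
  cliqueBoundedIn-mono A⊆B bound S S⊆A = bound S (A⊆B ∘ S⊆A)

  cliqueBoundedIn-0⇒Empty : CliqueBoundedIn A 0 → Empty A
  cliqueBoundedIn-0⇒Empty bound (v , v∈A)
    with bound ⁅ v ⁆ (λ u∈ → subst (_∈ _) (sym (x∈⁅y⁆⇒x≡y v u∈)) v∈A) singleton-clique
    where
    singleton-clique : IsClique H ⁅ v ⁆
    singleton-clique u w u∈ w∈ u≢w = ⊥-elim (u≢w (trans (x∈⁅y⁆⇒x≡y v u∈) (sym (x∈⁅y⁆⇒x≡y v w∈))))
  ... | ∣⁅v⁆∣≤0 rewrite ∣⁅x⁆∣≡1 v with ∣⁅v⁆∣≤0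
  ... | ()

  -- A clique among the neighbours of v extends by v.
  cliqueBoundedIn-nbrsIn : v ∈ A → CliqueBoundedIn A (suc ω) → CliqueBoundedIn (nbrsIn A v) ω
  cliqueBoundedIn-nbrsIn {v = v} {A = A} {ω = ω} v∈A bound S S⊆N clique =
    ℕ.s≤s⁻¹ (subst (_≤ suc ω) (x∉p⇒∣p∪⁅x⁆∣≡1+∣p∣ v∉S) (bound (S ∪ ⁅ v ⁆) S+v⊆A S+v-clique))
    where
    v∉S : v ∉ S
    v∉S v∈S = proj₁ (proj₂ (∈nbrsIn⁻ (S⊆N v∈S))) refl

    S+v⊆A : S ∪ ⁅ v ⁆ ⊆ A
    S+v⊆A u∈ with x∈p∪⁅y⁆⇒x∈p⊎x≡y u∈
    ... | inj₁ u∈S = nbrsIn-⊆ (S⊆N u∈S)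
    ... | inj₂ refl = v∈A

    S+v-clique : IsClique H (S ∪ ⁅ v ⁆)
    S+v-clique u w u∈ w∈ u≢w with x∈p∪⁅y⁆⇒x∈p⊎x≡y u∈ | x∈p∪⁅y⁆⇒x∈p⊎x≡y w∈
    ... | inj₁ u∈S  | inj₁ w∈S  = clique u w u∈S w∈S u≢w
    ... | inj₁ u∈S  | inj₂ refl = trans (symmetric H u w) (proj₂ (proj₂ (∈nbrsIn⁻ (S⊆N u∈S))))
    ... | inj₂ refl | inj₁ w∈S  = proj₂ (proj₂ (∈nbrsIn⁻ (S⊆N w∈S)))
    ... | inj₂ refl | inj₂ refl = ⊥-elim (u≢w refl)

  -- ∅ and the singletons
  indepFamily-size : ∀ m A → ∣ A ∣ ≡ m → IndepFamily A (suc m)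
  indepFamily-size zero    A _    = indepFamily-∅
  indepFamily-size (suc m) A ∣A∣≡ with ∣p∣≡1+m⇒Nonempty A ∣A∣≡
  ... | v , v∈A = subst (IndepFamily A) (+-comm (suc m) 1)
    (indepFamily-+ v∈A (indepFamily-size m (A - v) (x∈p⇒∣p-x∣≡m v∈A ∣A∣≡)) indepFamily-∅)

  indepFamily-2^∣A∣ : ∀ m A → ∣ A ∣ ≡ m → CliqueBoundedIn A 1 → IndepFamily A (2 ^ m)
  indepFamily-2^∣A∣ zero    A _    _     = indepFamily-∅
  indepFamily-2^∣A∣ (suc m) A ∣A∣≡ bound with ∣p∣≡1+m⇒Nonempty A ∣A∣≡
  ... | v , v∈A = subst (IndepFamily A) (cong (2 ^ m +_) (sym (+-identityʳ (2 ^ m))))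
    (indepFamily-+ v∈A
      (indepFamily-2^∣A∣ m (A - v) (x∈p⇒∣p-x∣≡m v∈A ∣A∣≡) (cliqueBoundedIn-mono x∈p-y⇒x∈p bound))
      (indepFamily-2^∣A∣ m (nonNbrsIn A v) ∣M∣≡m (cliqueBoundedIn-mono nonNbrsIn-⊆ bound)))
    where
    ∣N∣≡0 : ∣ nbrsIn A v ∣ ≡ 0
    ∣N∣≡0 = Empty⇒∣p∣≡0 (cliqueBoundedIn-0⇒Empty (cliqueBoundedIn-nbrsIn v∈A bound))
    ∣M∣≡m : ∣ nonNbrsIn A v ∣ ≡ m
    ∣M∣≡m = trans (cong (_+ ∣ nonNbrsIn A v ∣) (sym ∣N∣≡0))
                  (trans (∣nbrsIn∣+∣nonNbrsIn∣≡∣A-v∣ A v) (x∈p⇒∣p-x∣≡m v∈A ∣A∣≡))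

-- Arithmetic estimates

^-distribʳ-* : ∀ m n o → (m * n) ^ o ≡ m ^ o * n ^ o
^-distribʳ-* m n zero    = refl
^-distribʳ-* m n (suc o) =
  trans (cong (m * n *_) (^-distribʳ-* m n o)) ([m*n]*[o*p]≡[m*o]*[n*p] m n (m ^ o) (n ^ o))

bernoulli-upper : ∀ a d k → (a + d) ^ suc k ≤ a ^ suc k + suc k * d * (a + d) ^ k
bernoulli-upper a d zero = ≤-reflexive (ring a d)
  where
  ring : ∀ a d → (a + d) * 1 ≡ a * 1 + 1 * d * 1
  ring = solve-∀
bernoulli-upper a d (suc k) = begin
  (a + d) * (a + d) ^ suc k
    ≤⟨ *-monoʳ-≤ (a + d) (bernoulli-upper a d k) ⟩
  (a + d) * (a ^ suc k + suc k * d * (a + d) ^ k)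
    ≡⟨ ring₁ a d (a ^ suc k) ((a + d) ^ k) (suc k) ⟩
  a * a ^ suc k + d * a ^ suc k + suc k * d * ((a + d) * (a + d) ^ k)
    ≤⟨ +-monoˡ-≤ _ (+-monoʳ-≤ (a * a ^ suc k) (*-monoʳ-≤ d (^-monoˡ-≤ (suc k) (m≤m+n a d)))) ⟩
  a * a ^ suc k + d * ((a + d) * (a + d) ^ k) + suc k * d * ((a + d) * (a + d) ^ k)
    ≡⟨ ring₂ (a * a ^ suc k) d ((a + d) * (a + d) ^ k) (suc k) ⟩
  a * a ^ suc k + suc (suc k) * d * ((a + d) * (a + d) ^ k) ∎
  where
  open ≤-Reasoning
  ring₁ : ∀ a d x y m → (a + d) * (x + m * d * y) ≡ a * x + d * x + m * d * ((a + d) * y)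
  ring₁ = solve-∀
  ring₂ : ∀ u d z m → u + d * z + m * d * z ≡ u + (1 + m) * d * z
  ring₂ = solve-∀

bernoulli-lower : ∀ V k → k * V + 1 ≤ suc V ^ k
bernoulli-lower V zero    = ≤-refl
bernoulli-lower V (suc k) = begin
  suc k * V + 1                 ≤⟨ m≤m+n _ _ ⟩
  suc k * V + 1 + V * (k * V)   ≡⟨ ring V k ⟩
  suc V * (k * V + 1)           ≤⟨ *-monoʳ-≤ (suc V) (bernoulli-lower V k) ⟩
  suc V * suc V ^ k             ∎
  where
  open ≤-Reasoning
  ring : ∀ V k → (1 + k) * V + 1 + V * (k * V) ≡ (1 + V) * (k * V + 1)
  ring = solve-∀

k*W+1≤W^[1+k] : ∀ W k → 1 < W → k * W + 1 ≤ W ^ suc k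
k*W+1≤W^[1+k] (suc V@(suc _)) k (s≤s (s≤s z≤n)) = begin
  k * suc V + 1             ≤⟨ +-monoˡ-≤ 1 (*-monoʳ-≤ k (m≤n*m (suc V) V)) ⟩
  k * (V * suc V) + 1       ≤⟨ m≤m+n _ _ ⟩
  k * (V * suc V) + 1 + V   ≡⟨ ring V k ⟩
  suc V * (k * V + 1)       ≤⟨ *-monoʳ-≤ (suc V) (bernoulli-lower V k) ⟩
  suc V * suc V ^ k         ∎
  where
  open ≤-Reasoning
  ring : ∀ V k → k * (V * (1 + V)) + 1 + V ≡ (1 + V) * (k * V + 1)
  ring = solve-∀

[1+j]*n+P*j*d≤P*n : ∀ W P j d n → P ≤ n → d < W → j * W + 1 ≤ P →
                  suc j * n + P * j * d ≤ P * n
[1+j]*n+P*j*d≤P*n W P j d n P≤n d<W jW+1≤P = begin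
  suc j * n + P * j * d ≤⟨ +-monoʳ-≤ (suc j * n) (*-monoˡ-≤ d (*-monoˡ-≤ j P≤n)) ⟩
  suc j * n + n * j * d ≡⟨ ring j n d ⟩
  n * (j * suc d + 1)   ≤⟨ *-monoʳ-≤ n (+-monoˡ-≤ 1 (*-monoʳ-≤ j d<W)) ⟩
  n * (j * W + 1)       ≤⟨ *-monoʳ-≤ n jW+1≤P ⟩
  n * P                 ≡⟨ *-comm n P ⟩
  P * n                 ∎
  where
  open ≤-Reasoning
  ring : ∀ j n d → (1 + j) * n + n * j * d ≡ n * (j * (1 + d) + 1)
  ring = solve-∀

-- Write n = a + d with a = ⌊n/W⌋ W and d < W; Bernoulli bounds n^j by a^j plus a
-- correction, which [1+j]*n+P*j*d≤P*n absorbs since P = W^(j+1) ≤ n.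
power-vs-floor-div : ∀ W .{{_ : NonZero W}} j n → 1 < W → W ^ suc j < n →
                     suc j * n ^ j ≤ (n / W) ^ j * W ^ (j + suc j)
power-vs-floor-div W zero    n _ _ = ≤-trans (m^n>0 W 1) (≤-reflexive (sym (*-identityˡ _)))
power-vs-floor-div W (suc i) n 1<W P<n = begin
  suc j * n ^ j         ≤⟨ +-cancelʳ-≤ (P * j * d * X) _ _ (≤-trans upper lower) ⟩
  P * a ^ j             ≡⟨ cong (P *_) (^-distribʳ-* s W j) ⟩
  P * (s ^ j * W ^ j)   ≡⟨ ring P (s ^ j) (W ^ j) ⟩
  s ^ j * (W ^ j * P)   ≡⟨ cong (s ^ j *_) (^-distribˡ-+-* W j (suc j)) ⟨
  s ^ j * W ^ (j + suc j) ∎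
  where
  open ≤-Reasoning
  j = suc i
  s = n / W
  a = s * W
  d = n % W
  P = W ^ suc j
  X = n ^ i
  n≡a+d : n ≡ a + d
  n≡a+d = trans (m≡m%n+[m/n]*n n W) (+-comm d a)
  upper : suc j * n ^ j + P * j * d * X ≤ P * n ^ j
  upper = begin
    suc j * (n * X) + P * j * d * X ≡⟨ ring₁ (suc j) n X (P * j * d) ⟩
    (suc j * n + P * j * d) * X      ≤⟨ *-monoˡ-≤ X ([1+j]*n+P*j*d≤P*n W P j d n (<⇒≤ P<n) (m%n<n n W)
                                                        (k*W+1≤W^[1+k] W j 1<W)) ⟩
    P * n * X                        ≡⟨ *-assoc P n X ⟩
    P * (n * X)                      ∎
    where
    ring₁ : ∀ m n X Y → m * (n * X) + Y * X ≡ (m * n + Y) * X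
    ring₁ = solve-∀
  lower : P * n ^ j ≤ P * a ^ j + P * j * d * X
  lower = begin
    P * n ^ j                         ≡⟨ cong (λ t → P * t ^ j) n≡a+d ⟩
    P * (a + d) ^ j                   ≤⟨ *-monoʳ-≤ P (bernoulli-upper a d i) ⟩
    P * (a ^ j + j * d * (a + d) ^ i) ≡⟨ cong (λ t → P * (a ^ j + j * d * t ^ i)) n≡a+d ⟨
    P * (a ^ j + j * d * X)           ≡⟨ ring₂ P (a ^ j) j d X ⟩
    P * a ^ j + P * j * d * X         ∎
    where
    ring₂ : ∀ P A j d X → P * (A + j * d * X) ≡ P * A + P * j * d * X
    ring₂ = solve-∀
  ring : ∀ P A B → P * (A * B) ≡ A * (B * P)
  ring = solve-∀

deletion-bound : ∀ W .{{_ : NonZero W}} j m c l₁ l₂ → 1 < W → W ^ suc j < suc m →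
                 suc m / W ≤ c → m ^ suc j ≤ l₁ * W ^ (suc j * suc j) → c ^ j ≤ l₂ * W ^ (j * j) →
                 suc m ^ suc j ≤ (l₁ + l₂) * W ^ (suc j * suc j)
deletion-bound W j m c l₁ l₂ 1<W large ⌊n/W⌋≤c bound₁ bound₂ = begin
  suc m ^ k                                ≡⟨ cong (_^ k) (+-comm 1 m) ⟩
  (m + 1) ^ k                              ≤⟨ bernoulli-upper m 1 j ⟩
  m ^ k + k * 1 * (m + 1) ^ j              ≡⟨ cong₂ (λ x y → m ^ k + x * y ^ j) (*-identityʳ k) (+-comm m 1) ⟩
  m ^ k + k * suc m ^ j                    ≤⟨ +-mono-≤ bound₁ correction ⟩
  l₁ * W ^ (k * k) + l₂ * W ^ (k * k)      ≡⟨ *-distribʳ-+ (W ^ (k * k)) l₁ l₂ ⟨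
  (l₁ + l₂) * W ^ (k * k)                  ∎
  where
  open ≤-Reasoning
  k = suc j
  correction : k * suc m ^ j ≤ l₂ * W ^ (k * k)
  correction = begin
    k * suc m ^ j                       ≤⟨ power-vs-floor-div W j (suc m) 1<W large ⟩
    (suc m / W) ^ j * W ^ (j + k)       ≤⟨ *-monoˡ-≤ _ (^-monoˡ-≤ j ⌊n/W⌋≤c) ⟩
    c ^ j * W ^ (j + k)                 ≤⟨ *-monoˡ-≤ _ bound₂ ⟩
    l₂ * W ^ (j * j) * W ^ (j + k)      ≡⟨ *-assoc l₂ _ _ ⟩
    l₂ * (W ^ (j * j) * W ^ (j + k))    ≡⟨ cong (l₂ *_) (^-distribˡ-+-* W (j * j) (j + k)) ⟨
    l₂ * W ^ (j * j + (j + k))          ≡⟨ cong (λ t → l₂ * W ^ t) (ring j) ⟩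
    l₂ * W ^ (k * k)                    ∎
    where
    ring : ∀ j → j * j + (j + (1 + j)) ≡ (1 + j) * (1 + j)
    ring = solve-∀

-- From n ≤ b + ⌊n/(V+1)⌋ we get n V ≤ b (V+1); raise to the k-th power and cancel V^(k²).
neighbourhood-bound : ∀ V .{{_ : NonZero V}} j n b l → n ≤ b + n / suc V →
                      b ^ suc j ≤ l * V ^ (suc j * suc j) → n ^ suc j ≤ l * suc V ^ (suc j * suc j)
neighbourhood-bound V j n b l n≤b+⌊n/W⌋ bound =
  *-cancelʳ-≤ (n ^ k) (l * W ^ (k * k)) (V ^ (k * k)) {{m^n≢0 V (k * k)}} (begin
    n ^ k * V ^ (k * k)            ≡⟨ cong (n ^ k *_) (^-*-assoc V k k) ⟨
    n ^ k * (V ^ k) ^ k            ≡⟨ ^-distribʳ-* n (V ^ k) k ⟨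
    (n * V ^ k) ^ k                ≤⟨ ^-monoˡ-≤ k nV^k≤bW^k ⟩
    (b * W ^ k) ^ k                ≡⟨ ^-distribʳ-* b (W ^ k) k ⟩
    b ^ k * (W ^ k) ^ k            ≡⟨ cong (b ^ k *_) (^-*-assoc W k k) ⟩
    b ^ k * W ^ (k * k)            ≤⟨ *-monoˡ-≤ _ bound ⟩
    l * V ^ (k * k) * W ^ (k * k)  ≡⟨ ring l (V ^ (k * k)) (W ^ (k * k)) ⟩
    l * W ^ (k * k) * V ^ (k * k)  ∎)
  where
  open ≤-Reasoning
  W = suc V
  k = suc j
  s = n / W
  nV≤bW : n * V ≤ b * W
  nV≤bW = +-cancelʳ-≤ (s * W) _ _ (begin
    n * V + s * W     ≤⟨ +-monoʳ-≤ (n * V) (m/n*n≤m n W) ⟩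
    n * V + n         ≡⟨ ring₁ n V ⟩
    n * W             ≤⟨ *-monoˡ-≤ W n≤b+⌊n/W⌋ ⟩
    (b + s) * W       ≡⟨ *-distribʳ-+ W b s ⟩
    b * W + s * W     ∎)
    where
    ring₁ : ∀ n V → n * V + n ≡ n * (1 + V)
    ring₁ = solve-∀
  nV^k≤bW^k : n * V ^ k ≤ b * W ^ k
  nV^k≤bW^k = begin
    n * (V * V ^ j)   ≡⟨ *-assoc n V (V ^ j) ⟨
    n * V * V ^ j     ≤⟨ *-monoˡ-≤ (V ^ j) nV≤bW ⟩
    b * W * V ^ j     ≤⟨ *-monoʳ-≤ (b * W) (^-monoˡ-≤ j (n≤1+n V)) ⟩
    b * W * W ^ j     ≡⟨ *-assoc b W (W ^ j) ⟩
    b * (W * W ^ j)   ∎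
  ring : ∀ l x y → l * x * y ≡ l * y * x
  ring = solve-∀

1+n≤2^n : ∀ n → suc n ≤ 2 ^ n
1+n≤2^n zero    = ≤-refl
1+n≤2^n (suc n) = begin
  suc (suc n)     ≤⟨ s≤s (1+n≤2^n n) ⟩
  suc (2 ^ n)     ≤⟨ +-monoˡ-≤ (2 ^ n) (m^n>0 2 n) ⟩
  2 ^ n + 2 ^ n   ≡⟨ cong (2 ^ n +_) (+-identityʳ (2 ^ n)) ⟨
  2 * 2 ^ n       ∎
  where open ≤-Reasoning

2*n≤2^n : ∀ n → 2 * n ≤ 2 ^ n
2*n≤2^n zero    = z≤n
2*n≤2^n (suc n) = *-monoʳ-≤ 2 (1+n≤2^n n)

-- Write b = s k + r with r < k; then b ≤ (s+1) k and s+1 ≤ 2^s.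
n^k≤k^k*2^n : ∀ k .{{_ : NonZero k}} n → n ^ k ≤ k ^ k * 2 ^ n
n^k≤k^k*2^n k b = begin
  b ^ k                 ≤⟨ ^-monoˡ-≤ k b≤[1+s]k ⟩
  (suc s * k) ^ k       ≡⟨ ^-distribʳ-* (suc s) k k ⟩
  suc s ^ k * k ^ k     ≤⟨ *-monoˡ-≤ (k ^ k) (^-monoˡ-≤ k (1+n≤2^n s)) ⟩
  (2 ^ s) ^ k * k ^ k   ≡⟨ cong (_* k ^ k) (^-*-assoc 2 s k) ⟩
  2 ^ (s * k) * k ^ k   ≤⟨ *-monoˡ-≤ (k ^ k) (^-monoʳ-≤ 2 (m/n*n≤m b k)) ⟩
  2 ^ b * k ^ k         ≡⟨ *-comm (2 ^ b) (k ^ k) ⟩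
  k ^ k * 2 ^ b         ∎
  where
  open ≤-Reasoning
  s = b / k
  b≤[1+s]k : b ≤ suc s * k
  b≤[1+s]k = begin
    b               ≡⟨ m≡m%n+[m/n]*n b k ⟩
    b % k + s * k   ≤⟨ +-monoˡ-≤ (s * k) (<⇒≤ (m%n<n b k)) ⟩
    k + s * k       ∎

neighbourhood-bound₂ : ∀ j n b l → n ≤ b + n / 2 → 2 ^ b ≤ l → n ^ suc j ≤ l * 2 ^ (suc j * suc j)
neighbourhood-bound₂ j n b l n≤b+⌊n/2⌋ 2^b≤l = begin
  n ^ k                     ≤⟨ ^-monoˡ-≤ k n≤2b ⟩
  (2 * b) ^ k               ≡⟨ ^-distribʳ-* 2 b k ⟩
  2 ^ k * b ^ k             ≤⟨ *-monoʳ-≤ (2 ^ k) (n^k≤k^k*2^n k b) ⟩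
  2 ^ k * (k ^ k * 2 ^ b)   ≡⟨ *-assoc (2 ^ k) (k ^ k) (2 ^ b) ⟨
  2 ^ k * k ^ k * 2 ^ b     ≡⟨ cong (_* 2 ^ b) (^-distribʳ-* 2 k k) ⟨
  (2 * k) ^ k * 2 ^ b       ≤⟨ *-monoˡ-≤ (2 ^ b) (^-monoˡ-≤ k (2*n≤2^n k)) ⟩
  (2 ^ k) ^ k * 2 ^ b       ≡⟨ cong (_* 2 ^ b) (^-*-assoc 2 k k) ⟩
  2 ^ (k * k) * 2 ^ b       ≤⟨ *-monoʳ-≤ (2 ^ (k * k)) 2^b≤l ⟩
  2 ^ (k * k) * l           ≡⟨ *-comm (2 ^ (k * k)) l ⟩
  l * 2 ^ (k * k)           ∎
  where
  open ≤-Reasoning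
  k = suc j
  n≤2b : n ≤ 2 * b
  n≤2b = +-cancelʳ-≤ (n / 2 * 2) _ _ (begin
    n + n / 2 * 2         ≤⟨ +-monoʳ-≤ n (m/n*n≤m n 2) ⟩
    n + n                 ≡⟨ ring₁ n ⟩
    n * 2                 ≤⟨ *-monoˡ-≤ 2 n≤b+⌊n/2⌋ ⟩
    (b + n / 2) * 2       ≡⟨ ring₂ b (n / 2) ⟩
    2 * b + n / 2 * 2     ∎)
    where
    ring₁ : ∀ n → n + n ≡ n * 2
    ring₁ = solve-∀
    ring₂ : ∀ b t → (b + t) * 2 ≡ 2 * b + t * 2
    ring₂ = solve-∀

-- Counting independent sets

module _ {N : ℕ} (H : Graph N) where

  PowerBound : ℕ → ℕ → ℕ → Subset N → Set
  PowerBound ω k n A = Σ[ l ∈ ℕ ] IndepFamily H A l × n ^ k ≤ l * ω ^ (k * k)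

  PowerBounded : ℕ → ℕ → ℕ → Set
  PowerBounded ω k n = ∀ A → ∣ A ∣ ≡ n → CliqueBoundedIn H A ω → PowerBound ω k n A

  NbrsBounded : (ω : ℕ) .{{_ : NonZero ω}} → ℕ → ℕ → Set
  NbrsBounded ω k n = ∀ A {v} → v ∈ A → CliqueBoundedIn H A ω →
                      n ≤ ∣ nbrsIn H A v ∣ + n / ω → PowerBound ω k n A

  powerBounded-step : ∀ w j m → PowerBounded (2 + w) (suc j) m → (∀ c → PowerBounded (2 + w) j c) →
                      NbrsBounded (2 + w) (suc j) (suc m) → PowerBounded (2 + w) (suc j) (suc m)
  powerBounded-step w j m deleted nonNbrs nbrs A ∣A∣≡ bound with suc m ≤? (2 + w) ^ suc j
  ... | yes small = 1 , indepFamily-∅ H , (begin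
    suc m ^ k             ≤⟨ ^-monoˡ-≤ k small ⟩
    ((2 + w) ^ k) ^ k     ≡⟨ ^-*-assoc (2 + w) k k ⟩
    (2 + w) ^ (k * k)     ≡⟨ *-identityˡ _ ⟨
    1 * (2 + w) ^ (k * k) ∎)
    where
    open ≤-Reasoning
    k = suc j
  ... | no large with ∣p∣≡1+m⇒Nonempty A ∣A∣≡
  ... | v , v∈A with suc m / (2 + w) ≤? ∣ nonNbrsIn H A v ∣
  ... | no fewNonNbrs = nbrs A v∈A bound (begin
    suc m                                        ≡⟨ cong suc ∣N∣+∣M∣≡m ⟨
    suc (∣ nbrsIn H A v ∣ + ∣ nonNbrsIn H A v ∣) ≡⟨ +-suc _ _ ⟨
    ∣ nbrsIn H A v ∣ + suc ∣ nonNbrsIn H A v ∣   ≤⟨ +-monoʳ-≤ _ (≰⇒> fewNonNbrs) ⟩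
    ∣ nbrsIn H A v ∣ + suc m / (2 + w)          ∎)
    where
    open ≤-Reasoning
    ∣N∣+∣M∣≡m : ∣ nbrsIn H A v ∣ + ∣ nonNbrsIn H A v ∣ ≡ m
    ∣N∣+∣M∣≡m = trans (∣nbrsIn∣+∣nonNbrsIn∣≡∣A-v∣ H A v) (x∈p⇒∣p-x∣≡m v∈A ∣A∣≡)
  ... | yes manyNonNbrs
    with deleted (A - v) (x∈p⇒∣p-x∣≡m v∈A ∣A∣≡) (cliqueBoundedIn-mono H x∈p-y⇒x∈p bound)
       | nonNbrs _ (nonNbrsIn H A v) refl (cliqueBoundedIn-mono H (nonNbrsIn-⊆ H) bound)
  ... | l₁ , F₁ , bound₁ | l₂ , F₂ , bound₂ =
    l₁ + l₂ , indepFamily-+ H v∈A F₁ F₂ ,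
    deletion-bound (2 + w) j m _ l₁ l₂ (s≤s (s≤s z≤n)) (≰⇒> large) manyNonNbrs bound₁ bound₂

  powerBounded : ∀ w k n → PowerBounded (2 + w) k n
  nbrsBounded  : ∀ w j n → NbrsBounded (2 + w) (suc j) n

  powerBounded w zero    n       A _ _ = 1 , indepFamily-∅ H , ≤-refl
  powerBounded w (suc j) zero    A _ _ = 1 , indepFamily-∅ H , z≤n
  powerBounded w (suc j) (suc m) =
    powerBounded-step w j m (powerBounded w (suc j) m) (powerBounded w j) (nbrsBounded w j (suc m))

  nbrsBounded zero j n A {v} v∈A bound n≤∣N∣+⌊n/2⌋ =
    2 ^ ∣ nbrsIn H A v ∣ ,
    indepFamily-mono H (nbrsIn-⊆ H)
      (indepFamily-2^∣A∣ H _ (nbrsIn H A v) refl (cliqueBoundedIn-nbrsIn H v∈A bound)) ,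
    neighbourhood-bound₂ j n _ _ n≤∣N∣+⌊n/2⌋ ≤-refl
  nbrsBounded (suc w) j n A {v} v∈A bound n≤∣N∣+⌊n/ω⌋
    with powerBounded w (suc j) _ (nbrsIn H A v) refl (cliqueBoundedIn-nbrsIn H v∈A bound)
  ... | l , F , boundN =
    l , indepFamily-mono H (nbrsIn-⊆ H) F , neighbourhood-bound (2 + w) j n _ l n≤∣N∣+⌊n/ω⌋ boundN

n^k≤indepCount*ω^[k*k] : ∀ {n} (H : Graph n) w → CliqueFreeAbove H (2 + w) →
                         ∀ k → n ^ k ≤ indepCount H * (2 + w) ^ (k * k)
n^k≤indepCount*ω^[k*k] {n} H w cliqueFree k
  with powerBounded H w k n ⊤ (∣⊤∣≡n n) (λ S _ → cliqueFree S)
... | l , F , bound = ≤-trans bound (*-monoˡ-≤ _ (indepFamily⇒≤indepCount H F))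

n<indepCount : ∀ {n} (H : Graph n) → n < indepCount H
n<indepCount {n} H = indepFamily⇒≤indepCount H (indepFamily-size H n ⊤ (∣⊤∣≡n n))

-- Logarithms

2^m≤2^n⇒m≤n : ∀ m n → 2 ^ m ≤ 2 ^ n → m ≤ n
2^m≤2^n⇒m≤n m n 2^m≤2^n = ≮⇒≥ (λ n<m → <⇒≱ (^-monoʳ-< 2 (s≤s (s≤s z≤n)) n<m) 2^m≤2^n)

2^m<2^n⇒m<n : ∀ m n → 2 ^ m < 2 ^ n → m < n
2^m<2^n⇒m<n m n 2^m<2^n = ≰⇒> (λ n≤m → <⇒≱ 2^m<2^n (^-monoʳ-≤ 2 n≤m))

-- In logarithmic terms: t/U < log n ≤ log i < p/Q.
size-exponent-bound : ∀ {i n} p Q t U → i ^ Q < 2 ^ p → 2 ^ t < n ^ U → n ≤ i → t * Q ≤ p * U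
size-exponent-bound {i} {n} p Q t U i^Q<2^p 2^t<n^U n≤i = 2^m≤2^n⇒m≤n _ _ (begin
  2 ^ (t * Q)   ≡⟨ ^-*-assoc 2 t Q ⟨
  (2 ^ t) ^ Q   ≤⟨ ^-monoˡ-≤ Q (<⇒≤ 2^t<n^U) ⟩
  (n ^ U) ^ Q   ≡⟨ ^-*-assoc n U Q ⟩
  n ^ (U * Q)   ≡⟨ cong (n ^_) (*-comm U Q) ⟩
  n ^ (Q * U)   ≡⟨ ^-*-assoc n Q U ⟨
  (n ^ Q) ^ U   ≤⟨ ^-monoˡ-≤ U (^-monoˡ-≤ Q n≤i) ⟩
  (i ^ Q) ^ U   ≤⟨ ^-monoˡ-≤ U (<⇒≤ i^Q<2^p) ⟩
  (2 ^ p) ^ U   ≡⟨ ^-*-assoc 2 p U ⟩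
  2 ^ (p * U)   ∎)
  where open ≤-Reasoning

-- In logarithmic terms: k t/U < k log n ≤ log i + k² log ω < p/Q + k² r/S.
power-exponent-bound : ∀ {i n ω} p Q r S t U k .{{_ : NonZero (k * Q * S)}} →
  i ^ Q < 2 ^ p → ω ^ S < 2 ^ r → 2 ^ t < n ^ U → n ^ k ≤ i * ω ^ (k * k) →
  t * (k * Q * S) < p * (U * S) + r * (k * k * U * Q)
power-exponent-bound {i} {n} {ω} p Q r S t U k i^Q<2^p ω^S<2^r 2^t<n^U bound =
  2^m<2^n⇒m<n _ _ (begin-strict
    2 ^ (t * (k * Q * S))                    ≡⟨ ^-*-assoc 2 t (k * Q * S) ⟨
    (2 ^ t) ^ (k * Q * S)                    <⟨ ^-monoˡ-< (k * Q * S) 2^t<n^U ⟩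
    (n ^ U) ^ (k * Q * S)                    ≡⟨ regroup n U (k * Q * S) k (U * Q * S) (ring₁ U k Q S) ⟩
    (n ^ k) ^ (U * Q * S)                    ≤⟨ ^-monoˡ-≤ (U * Q * S) bound ⟩
    (i * ω ^ (k * k)) ^ (U * Q * S)          ≡⟨ ^-distribʳ-* i (ω ^ (k * k)) (U * Q * S) ⟩
    i ^ (U * Q * S) * (ω ^ (k * k)) ^ (U * Q * S)
      ≡⟨ cong₂ _*_ (trans (cong (i ^_) (ring₂ U Q S)) (sym (^-*-assoc i Q (U * S))))
                   (regroup ω (k * k) (U * Q * S) S (k * k * U * Q) (ring₃ k U Q S)) ⟩
    (i ^ Q) ^ (U * S) * (ω ^ S) ^ (k * k * U * Q)
      ≤⟨ *-mono-≤ (^-monoˡ-≤ (U * S) (<⇒≤ i^Q<2^p)) (^-monoˡ-≤ (k * k * U * Q) (<⇒≤ ω^S<2^r)) ⟩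
    (2 ^ p) ^ (U * S) * (2 ^ r) ^ (k * k * U * Q)
      ≡⟨ cong₂ _*_ (^-*-assoc 2 p (U * S)) (^-*-assoc 2 r (k * k * U * Q)) ⟩
    2 ^ (p * (U * S)) * 2 ^ (r * (k * k * U * Q))
      ≡⟨ ^-distribˡ-+-* 2 (p * (U * S)) (r * (k * k * U * Q)) ⟨
    2 ^ (p * (U * S) + r * (k * k * U * Q))  ∎)
  where
  open ≤-Reasoning
  regroup : ∀ x a b c d → a * b ≡ c * d → (x ^ a) ^ b ≡ (x ^ c) ^ d
  regroup x a b c d eq = trans (^-*-assoc x a b) (trans (cong (x ^_) eq) (sym (^-*-assoc x c d)))
  ring₁ : ∀ U k Q S → U * (k * Q * S) ≡ k * (U * Q * S)
  ring₁ = solve-∀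
  ring₂ : ∀ U Q S → U * Q * S ≡ Q * (U * S)
  ring₂ = solve-∀
  ring₃ : ∀ k U Q S → k * k * (U * Q * S) ≡ S * (k * k * U * Q)
  ring₃ = solve-∀

quadratic-estimate : ∀ R k e → e ≤ 2 * R → 1 ≤ k →
                     3 * ((e + k * (2 * R)) * (e + k * (2 * R))) ≤ 16 * R * k * (R * k + e)
quadratic-estimate R k e e≤2R 1≤k = begin
  3 * ((e + k * (2 * R)) * (e + k * (2 * R)))
    ≡⟨ ring₁ R k e ⟩
  3 * e * e + (12 * R * k * e + 12 * (R * R) * (k * k))
    ≤⟨ +-monoˡ-≤ _ 3e²≤ ⟩
  4 * R * k * e + 4 * (R * R) * (k * k) + (12 * R * k * e + 12 * (R * R) * (k * k))
    ≡⟨ ring₂ R k e ⟩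
  16 * R * k * (R * k + e) ∎
  where
  open ≤-Reasoning
  ring₁ : ∀ R k e → 3 * ((e + k * (2 * R)) * (e + k * (2 * R))) ≡
                    3 * e * e + (12 * R * k * e + 12 * (R * R) * (k * k))
  ring₁ = solve-∀
  ring₂ : ∀ R k e → 4 * R * k * e + 4 * (R * R) * (k * k) + (12 * R * k * e + 12 * (R * R) * (k * k)) ≡
                    16 * R * k * (R * k + e)
  ring₂ = solve-∀
  3e²≤ : 3 * e * e ≤ 4 * R * k * e + 4 * (R * R) * (k * k)
  3e²≤ = begin
    3 * e * e                       ≤⟨ *-monoʳ-≤ (3 * e) e≤2R ⟩
    3 * e * (2 * R)                 ≡⟨ ring₃ e R ⟩
    4 * R * 1 * e + 2 * R * e       ≤⟨ +-mono-≤ (*-monoˡ-≤ e (*-monoʳ-≤ (4 * R) 1≤k)) (*-monoʳ-≤ (2 * R) e≤2R) ⟩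
    4 * R * k * e + 2 * R * (2 * R) ≡⟨ cong (4 * R * k * e +_) (ring₄ R) ⟩
    4 * R * k * e + 4 * (R * R) * 1 ≤⟨ +-monoʳ-≤ (4 * R * k * e) (*-monoʳ-≤ (4 * (R * R)) (*-mono-≤ 1≤k 1≤k)) ⟩
    4 * R * k * e + 4 * (R * R) * (k * k) ∎
    where
    ring₃ : ∀ e R → 3 * e * (2 * R) ≡ 4 * R * 1 * e + 2 * R * e
    ring₃ = solve-∀
    ring₄ : ∀ R → 2 * R * (2 * R) ≡ 4 * (R * R) * 1
    ring₄ = solve-∀

-- The rational approximations p/Q > log i, r/S > log ω and t/U < log n satisfy
-- (t/U)² ≤ (16/3) (p/Q) (r/S).  If log n < 2 log ω this follows from n ≤ i; otherwise take
-- k = ⌊(t/U) / (2 r/S)⌋ ≥ 1 in the power bound.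
log-square-bound : ∀ {i n ω} .{{_ : NonZero ω}} p Q r S t U .{{_ : NonZero Q}} .{{_ : NonZero S}} .{{_ : NonZero U}} →
  i ^ Q < 2 ^ p → ω ^ S < 2 ^ r → 2 ^ t < n ^ U → n ≤ i → (∀ k → n ^ k ≤ i * ω ^ (k * k)) →
  3 * (t * t) * (Q * S) ≤ 16 * (p * r) * (U * U)
log-square-bound p Q r S t U i^Q<2^p ω^S<2^r 2^t<n^U n≤i bound with 2 * (r * U) ≤? t * S
... | no tS<2rU = begin
  3 * (t * t) * (Q * S)        ≡⟨ ring₁ t Q S ⟩
  3 * (t * Q) * (t * S)        ≤⟨ *-mono-≤ (*-monoʳ-≤ 3 (size-exponent-bound p Q t U i^Q<2^p 2^t<n^U n≤i))
                                           (<⇒≤ (≰⇒> tS<2rU)) ⟩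
  3 * (p * U) * (2 * (r * U))  ≡⟨ ring₂ p U r ⟩
  6 * (p * r) * (U * U)        ≤⟨ *-monoˡ-≤ (U * U) (*-monoˡ-≤ (p * r) (m≤m+n 6 10)) ⟩
  16 * (p * r) * (U * U)       ∎
  where
  open ≤-Reasoning
  ring₁ : ∀ t Q S → 3 * (t * t) * (Q * S) ≡ 3 * (t * Q) * (t * S)
  ring₁ = solve-∀
  ring₂ : ∀ p U r → 3 * (p * U) * (2 * (r * U)) ≡ 6 * (p * r) * (U * U)
  ring₂ = solve-∀
... | yes 2rU≤tS = *-cancelʳ-≤ _ _ S (begin
  3 * (t * t) * (Q * S) * S                        ≡⟨ ring₁ t Q S ⟩
  3 * (T * T) * Q                                  ≡⟨ cong (λ x → 3 * (x * x) * Q) T≡e+kD ⟩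
  3 * ((e + k * (2 * R)) * (e + k * (2 * R))) * Q  ≤⟨ *-monoˡ-≤ Q (quadratic-estimate R k e (<⇒≤ e<D) 1≤k) ⟩
  16 * R * k * (R * k + e) * Q                     ≡⟨ ring₂ R k e Q ⟩
  16 * R * (k * Q * (R * k + e))                   ≤⟨ *-monoʳ-≤ (16 * R) kQ[Rk+e]≤pUS ⟩
  16 * R * (p * (U * S))                           ≡⟨ ring₃ r U p S ⟩
  16 * (p * r) * (U * U) * S                       ∎)
  where
  open ≤-Reasoning
  T = t * S
  R = r * U
  D = 2 * R
  1≤r : 1 ≤ r
  1≤r = 2^m<2^n⇒m<n 0 r (≤-<-trans (m^n>0 _ S) ω^S<2^r)
  instance
    D≢0 : NonZero D
    D≢0 = >-nonZero (*-mono-≤ (s≤s (z≤n {1})) (*-mono-≤ 1≤r (>-nonZero⁻¹ U)))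
  k = T / D
  e = T % D
  T≡e+kD : T ≡ e + k * D
  T≡e+kD = m≡m%n+[m/n]*n T D
  e<D : e < D
  e<D = m%n<n T D
  1≤k : 1 ≤ k
  1≤k = m≥n⇒m/n>0 2rU≤tS
  instance
    kQS≢0 : NonZero (k * Q * S)
    kQS≢0 = m*n≢0 (k * Q) S {{m*n≢0 k Q {{>-nonZero 1≤k}}}}
  kQ[Rk+e]≤pUS : k * Q * (R * k + e) ≤ p * (U * S)
  kQ[Rk+e]≤pUS = <⇒≤ (+-cancelʳ-< _ _ _ (begin-strict
    k * Q * (R * k + e) + r * (k * k * U * Q) ≡⟨ ring₄ k Q e r U ⟨
    k * Q * (e + k * (2 * R))                 ≡⟨ cong (k * Q *_) T≡e+kD ⟨
    k * Q * T                                 ≡⟨ ring₅ t k Q S ⟩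
    t * (k * Q * S)                           <⟨ power-exponent-bound p Q r S t U k i^Q<2^p ω^S<2^r 2^t<n^U (bound k) ⟩
    p * (U * S) + r * (k * k * U * Q)         ∎))
    where
    ring₄ : ∀ k Q e r U → k * Q * (e + k * (2 * (r * U))) ≡ k * Q * (r * U * k + e) + r * (k * k * U * Q)
    ring₄ = solve-∀
    ring₅ : ∀ t k Q S → k * Q * (t * S) ≡ t * (k * Q * S)
    ring₅ = solve-∀
  ring₁ : ∀ t Q S → 3 * (t * t) * (Q * S) * S ≡ 3 * ((t * S) * (t * S)) * Q
  ring₁ = solve-∀
  ring₂ : ∀ R k e Q → 16 * R * k * (R * k + e) * Q ≡ 16 * R * (k * Q * (R * k + e))
  ring₂ = solve-∀
  ring₃ : ∀ r U p S → 16 * (r * U) * (p * (U * S)) ≡ 16 * (p * r) * (U * U) * S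
  ring₃ = solve-∀

ℚᵘ-w*w≤2x*[y*8/3] : ∀ t w′ p x′ r y′ →
  3 * (t * t) * (suc x′ * suc y′) ≤ 16 * (p * r) * (suc w′ * suc w′) →
  ℚᵘ.mkℚᵘ (ℤ.+ t) w′ ℚᵘ.* ℚᵘ.mkℚᵘ (ℤ.+ t) w′ ℚᵘ.≤
  (ℚᵘ.mkℚᵘ (ℤ.+ 2) 0 ℚᵘ.* ℚᵘ.mkℚᵘ (ℤ.+ p) x′) ℚᵘ.* (ℚᵘ.mkℚᵘ (ℤ.+ r) y′ ℚᵘ.* ℚᵘ.mkℚᵘ (ℤ.+ 8) 2)
ℚᵘ-w*w≤2x*[y*8/3] t w′ p x′ r y′ bound = ℚᵘ.*≤* (begin
  (ℤ.+ t ℤ.* ℤ.+ t) ℤ.* ℤ.+ ((1 * X) * (Y * 3))      ≡⟨ cong (ℤ._* ℤ.+ ((1 * X) * (Y * 3))) (ℤP.pos-* t t) ⟨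
  ℤ.+ (t * t) ℤ.* ℤ.+ ((1 * X) * (Y * 3))          ≡⟨ ℤP.pos-* (t * t) _ ⟨
  ℤ.+ (t * t * ((1 * X) * (Y * 3)))              ≤⟨ +≤+ (≤-trans (≤-reflexive (ring₁ t X Y))
                                                     (≤-trans bound (≤-reflexive (ring₂ p r W)))) ⟩
  ℤ.+ (2 * p * (r * 8) * (W * W))                ≡⟨ ℤP.pos-* (2 * p * (r * 8)) (W * W) ⟩
  ℤ.+ (2 * p * (r * 8)) ℤ.* ℤ.+ (W * W)            ≡⟨ cong (ℤ._* ℤ.+ (W * W)) (trans (ℤP.pos-* (2 * p) (r * 8))
                                                     (cong₂ ℤ._*_ (ℤP.pos-* 2 p) (ℤP.pos-* r 8))) ⟩
  (ℤ.+ 2 ℤ.* ℤ.+ p) ℤ.* (ℤ.+ r ℤ.* ℤ.+ 8) ℤ.* ℤ.+ (W * W) ∎)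
  where
  open ℤP.≤-Reasoning
  X = suc x′
  Y = suc y′
  W = suc w′
  ring₁ : ∀ t X Y → t * t * ((1 * X) * (Y * 3)) ≡ 3 * (t * t) * (X * Y)
  ring₁ = solve-∀
  ring₂ : ∀ p r W → 16 * (p * r) * (W * W) ≡ 2 * p * (r * 8) * (W * W)
  ring₂ = solve-∀

w*w≤2x*[y*8/3] : ∀ (w x y : ℚ) {t p r} → ↥ w ≡ ℤ.+ t → ↥ x ≡ ℤ.+ p → ↥ y ≡ ℤ.+ r →
  3 * (t * t) * (↧ₙ x * ↧ₙ y) ≤ 16 * (p * r) * (↧ₙ w * ↧ₙ w) →
  w ℚ.* w ℚ.≤ (ℤ.+ 2 ℚ./ 1 ℚ.* x) ℚ.* (y ℚ.* (ℤ.+ 8 ℚ./ 3))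
w*w≤2x*[y*8/3] w@(mkℚ _ w′ _) x@(mkℚ _ x′ _) y@(mkℚ _ y′ _) {t} {p} {r} refl refl refl bound =
  ℚP.toℚᵘ-cancel-≤ (ℚᵘP.≤-respˡ-≃ (ℚᵘP.≃-sym (ℚP.toℚᵘ-homo-* w w))
                    (ℚᵘP.≤-respʳ-≃ (ℚᵘP.≃-sym rhs≃) (ℚᵘ-w*w≤2x*[y*8/3] t w′ p x′ r y′ bound)))
  where
  rhs≃ : toℚᵘ ((ℤ.+ 2 ℚ./ 1 ℚ.* x) ℚ.* (y ℚ.* (ℤ.+ 8 ℚ./ 3))) ℚᵘ.≃
         (ℚᵘ.mkℚᵘ (ℤ.+ 2) 0 ℚᵘ.* ℚᵘ.mkℚᵘ (ℤ.+ p) x′) ℚᵘ.* (ℚᵘ.mkℚᵘ (ℤ.+ r) y′ ℚᵘ.* ℚᵘ.mkℚᵘ (ℤ.+ 8) 2)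
  rhs≃ = ℚᵘP.≃-trans (ℚP.toℚᵘ-homo-* (ℤ.+ 2 ℚ./ 1 ℚ.* x) (y ℚ.* (ℤ.+ 8 ℚ./ 3)))
           (ℚᵘP.*-cong (ℚP.toℚᵘ-homo-* (ℤ.+ 2 ℚ./ 1) x) (ℚP.toℚᵘ-homo-* y (ℤ.+ 8 ℚ./ 3)))

2xy*-monoʳ-≤ : ∀ (x y : ℚ) {p r a b} → ↥ x ≡ ℤ.+ p → ↥ y ≡ ℤ.+ r → a ℚ.≤ b →
               (ℤ.+ 2 ℚ./ 1 ℚ.* x) ℚ.* (y ℚ.* a) ℚ.≤ (ℤ.+ 2 ℚ./ 1 ℚ.* x) ℚ.* (y ℚ.* b)
2xy*-monoʳ-≤ x@(mkℚ _ _ _) y@(mkℚ _ _ _) refl refl a≤b =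
  ℚP.*-monoˡ-≤-nonNeg (ℤ.+ 2 ℚ./ 1 ℚ.* x) {{ℚP.nonNeg*nonNeg⇒nonNeg (ℤ.+ 2 ℚ./ 1) x}}
    (ℚP.*-monoˡ-≤-nonNeg y a≤b)

logBound : ∀ w {n} (H : Graph n) → CliqueFreeAbove H (2 + w) → LogBound n (2 + w) (indepCount H)
logBound w H cliqueFree x y z v (p , ↥x≡p , i^Q<2^p) (r , ↥y≡r , ω^S<2^r) (e , e<z , partial≤e)
         (t , ↥v≡t , 2^t<n^U) =
  ℚP.≤-trans (w*w≤2x*[y*8/3] v x y ↥v≡t ↥x≡p ↥y≡r
               (log-square-bound p (↧ₙ x) r (↧ₙ y) t (↧ₙ v) i^Q<2^p ω^S<2^r 2^t<n^U
                 (<⇒≤ (n<indepCount H)) (n^k≤indepCount*ω^[k*k] H w cliqueFree)))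
             (2xy*-monoʳ-≤ x y ↥x≡p ↥y≡r 8/3≤z)
  where
  -- ePartial 4 = 1 + 1 + 1/2 + 1/6 = 8/3, and 2·(8/3) = 16/3 is the constant obtained above.
  8/3≤z : ℤ.+ 8 ℚ./ 3 ℚ.≤ z
  8/3≤z = ℚP.<⇒≤ (ℚP.≤-<-trans (partial≤e 4) e<z)

lemma4p4 : Σ ℕ λ n₀ → ∀ (ω : ℕ) → 2 ≤ ω → ∀ (n : ℕ) → n₀ ≤ n →
    (H : Graph n) → CliqueFreeAbove H ω → LogBound n ω (indepCount H)
lemma4p4 = 0 , λ { .(2 + w) (s≤s (s≤s {n = w} _)) n _ H → logBound w H }
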